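{- Let $T_1,T_2$ be planar rooted trees with $n$ nodes. Then $u_{T_1}(k)\subseteq u_{T_2}(k)$ for every node $k$ if and only if $d_{T_1}(k)\subseteq d_{T_2}(k)$ for every node $k$.
   Context: Nodes of a planar (ordered) rooted tree are labelled by the preorder traversal (root first, then recursively the subtrees of its children from left to right), and nodes of different trees with the same number of nodes are identified via their labels. For a node $k$ of $T$, $u_T(k)$ is the set of (proper) descendants of $k$, $h_T(k)$ is the set of (proper) ancestors of $k$, and $d_T(k)=u_T(k)\cup h_T(k)$. -}

module Defs where

open import Data.Nat using (ℕ; zero; suc; _+_; _≤_; _<_)
open import Data.List using (List; []; _∷_)
open import Data.Sum using (_⊎_)

data Tree : Set where
  node : List Tree → Tree

mutual
  size : Tree → ℕ
  size (node ts) = suc (sizeF ts)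

  sizeF : List Tree → ℕ
  sizeF [] = 0
  sizeF (t ∷ ts) = size t + sizeF ts

-- Nodes are labelled 0 .. size-1 in preorder (root = 0, then the subtrees of the
-- children from left to right).
mutual
  data Anc : Tree → ℕ → ℕ → Set where
    root  : ∀ {ts j} → 1 ≤ j → j < size (node ts) → Anc (node ts) 0 j
    child : ∀ {ts i j} → AncF ts i j → Anc (node ts) (suc i) (suc j)

  data AncF : List Tree → ℕ → ℕ → Set where
    here  : ∀ {t ts i j} → Anc t i j → AncF (t ∷ ts) i j
    there : ∀ {t ts i j} → AncF ts i j → AncF (t ∷ ts) (size t + i) (size t + j)

u : Tree → ℕ → ℕ → Set
u T k j = Anc T k j

h : Tree → ℕ → ℕ → Set
h T k j = Anc T j k

d : Tree → ℕ → ℕ → Set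
d T k j = u T k j ⊎ h T k j

-- In preorder every ancestor is labelled before its descendants, so u T and
-- its converse h T live strictly above and strictly below the diagonal.
-- Hence an inclusion of the symmetric relations d = u ∪ h cannot send a
-- descendant of k to an ancestor of k, and restricts to an inclusion of u;
-- conversely an ancestor j of k has j < k, so the u-inclusion at node j
-- already covers it.
module Submission where

open import Defs
open import Data.Nat using (ℕ; _<_; s≤s)
open import Data.Nat.Properties using (+-monoʳ-<; <-trans; <-asym)
open import Data.Sum using (_⊎_; inj₁; inj₂)
open import Data.Empty using (⊥-elim)
open import Relation.Binary.PropositionalEquality using (_≡_)
open import Function.Bundles using (_⇔_; mk⇔)

mutual
  Anc⇒< : ∀ {T i j} → Anc T i j → i < j
  Anc⇒< (root 1≤j _) = 1≤j
  Anc⇒< (child a)    = s≤s (AncF⇒< a)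

  AncF⇒< : ∀ {ts i j} → AncF ts i j → i < j
  AncF⇒< (here a)          = Anc⇒< a
  AncF⇒< (there {t = t} a) = +-monoʳ-< (size t) (AncF⇒< a)

module _ (R S : ℕ → ℕ → Set)
         (R⇒< : ∀ {i j} → R i j → i < j) (S⇒< : ∀ {i j} → S i j → i < j) where

  ⊆-below⇔⊆-below-symmetric : (n : ℕ) →
    ((∀ k → k < n → ∀ j → R k j → S k j) ⇔
     (∀ k → k < n → ∀ j → R k j ⊎ R j k → S k j ⊎ S j k))
  ⊆-below⇔⊆-below-symmetric n = mk⇔ to from
    where
    to : (∀ k → k < n → ∀ j → R k j → S k j) →
         (∀ k → k < n → ∀ j → R k j ⊎ R j k → S k j ⊎ S j k)
    to R⊆S k k<n j (inj₁ Rkj) = inj₁ (R⊆S k k<n j Rkj)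
    to R⊆S k k<n j (inj₂ Rjk) = inj₂ (R⊆S j (<-trans (R⇒< Rjk) k<n) k Rjk)

    from : (∀ k → k < n → ∀ j → R k j ⊎ R j k → S k j ⊎ S j k) →
           (∀ k → k < n → ∀ j → R k j → S k j)
    from R̂⊆Ŝ k k<n j Rkj with R̂⊆Ŝ k k<n j (inj₁ Rkj)
    ... | inj₁ Skj = Skj
    ... | inj₂ Sjk = ⊥-elim (<-asym (R⇒< Rkj) (S⇒< Sjk))

-- The size hypotheses only say that n ranges over the common node set; the
-- equivalence holds for every bound n.
mainTheorem6 : (n : ℕ) (T₁ T₂ : Tree) → size T₁ ≡ n → size T₂ ≡ n →
    ((∀ k → k < n → ∀ j → u T₁ k j → u T₂ k j) ⇔
     (∀ k → k < n → ∀ j → d T₁ k j → d T₂ k j))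
mainTheorem6 n T₁ T₂ _ _ =
  ⊆-below⇔⊆-below-symmetric (u T₁) (u T₂) Anc⇒< Anc⇒< n
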